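{- Let $A,B$ be positive integers such that $(A,B)$ is a polynomial pair. Then $(A,B)$ is a palindromic pair, i.e. $A^{*}\times B^{*}=(A\times B)^{*}$.
   Context: For a positive integer $A$ with decimal representation $A=\sum_{i=0}^{a} a_i 10^i$ (digits $a_i\in\{0,\dots,9\}$, $a_a\neq 0$), define $P(A,x)=\sum_{i=0}^{a} a_i x^i$ and its reciprocal $P^{*}(A,x)=\sum_{i=0}^{a} a_i x^{a-i}=x^aP(A,1/x)$. The reversal of $A$ is $A^{*}=P^{*}(A,10)=\sum_{i=0}^a a_i10^{a-i}$ (the number obtained by reading the decimal digits of $A$ backwards). A pair $(A,B)$ is a polynomial pair if $P(A,x)P(B,x)=P(A\times B,x)$, and a palindromic pair if $P^{*}(A,10)P^{*}(B,10)=P^{*}(A\times B,10)$. -}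

module Defs where

open import Data.Nat using (ℕ; zero; suc; _+_; _*_; _/_; _%_)
open import Data.List using (List; []; _∷_; map; reverse)
open import Relation.Binary.PropositionalEquality using (_≡_)

-- Decimal digits of n, least significant first (a_0, a_1, ..., a_a),
-- with no leading (most significant) zeros; digits 0 = [].
-- The first argument is fuel; n steps always suffice since n/10 < n for n > 0.
digitsAux : ℕ → ℕ → List ℕ
digitsAux zero    _       = []
digitsAux (suc f) zero    = []
digitsAux (suc f) (suc n) = (suc n % 10) ∷ digitsAux f (suc n / 10)

digits : ℕ → List ℕ
digits n = digitsAux n n

-- Polynomials with ℕ coefficients as coefficient lists (constant term first).
-- Polynomial addition and multiplication.
polyAdd : List ℕ → List ℕ → List ℕ
polyAdd []       qs       = qs
polyAdd (p ∷ ps) []       = p ∷ ps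
polyAdd (p ∷ ps) (q ∷ qs) = (p + q) ∷ polyAdd ps qs

polyMul : List ℕ → List ℕ → List ℕ
polyMul []       qs = []
polyMul (p ∷ ps) qs = polyAdd (map (p *_) qs) (0 ∷ polyMul ps qs)

P : ℕ → List ℕ
P A = digits A

eval : List ℕ → ℕ → ℕ
eval []       x = 0
eval (c ∷ cs) x = c + x * eval cs x

P* : ℕ → List ℕ
P* A = reverse (digits A)

rev : ℕ → ℕ
rev A = eval (P* A) 10

PolynomialPair : ℕ → ℕ → Set
PolynomialPair A B = polyMul (P A) (P B) ≡ P (A * B)

PalindromicPair : ℕ → ℕ → Set
PalindromicPair A B = rev A * rev B ≡ rev (A * B)

module Submission where

-- For a coefficient list cs = (c₀, …, cₙ) write
-- evalRec z cs = Σ cᵢ z^(n-i) for the value at z of the reciprocal polynomial,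
-- so that rev A = evalRec 10 (digits A).  Reciprocal evaluation is
-- multiplicative on non-empty coefficient lists:
--     evalRec z (polyMul p q) = evalRec z p * evalRec z q,
-- because the product of lists of lengths l and m has length l + m - 1, i.e. the
-- "degree" bookkeeping of the reciprocal works out exactly (no coefficient is
-- ever discarded).  For A, B > 0 the digit lists are non-empty, so a polynomial
-- pair P(A)P(B) = P(AB) gives rev A * rev B = evalRec 10 (P A · P B)
-- = evalRec 10 (P (AB)) = rev (AB).

open import Defs
open import Data.Nat using (ℕ; suc; _+_; _*_; _^_; _>_; _%_; _/_)
open import Data.Nat.Properties
  using (+-identityʳ; +-comm; +-suc; *-zeroʳ; suc-injective; ^-distribˡ-+-*)
open import Data.List using (List; []; _∷_; map; reverse; length; _++_; [_])
open import Data.List.Properties using (length-map; length-reverse; unfold-reverse)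
open import Data.Nat.Tactic.RingSolver using (solve-∀)
open import Relation.Binary.PropositionalEquality
  using (_≡_; refl; sym; trans; cong; cong₂; module ≡-Reasoning)
open ≡-Reasoning

evalRec : ℕ → List ℕ → ℕ
evalRec z []       = 0
evalRec z (c ∷ cs) = c * z ^ length cs + evalRec z cs

eval-++ : ∀ z xs ys → eval (xs ++ ys) z ≡ eval xs z + z ^ length xs * eval ys z
eval-++ z []       ys = sym (+-identityʳ _)
eval-++ z (x ∷ xs) ys = begin
  x + z * eval (xs ++ ys) z                       ≡⟨ cong (λ e → x + z * e) (eval-++ z xs ys) ⟩
  x + z * (eval xs z + z ^ length xs * eval ys z) ≡⟨ shift x z (eval xs z) (z ^ length xs) (eval ys z) ⟩
  x + z * eval xs z + z * z ^ length xs * eval ys z ∎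
  where
  shift : ∀ x z a p b → x + z * (a + p * b) ≡ x + z * a + z * p * b
  shift = solve-∀

eval-reverse : ∀ z cs → eval (reverse cs) z ≡ evalRec z cs
eval-reverse z []       = refl
eval-reverse z (c ∷ cs) = begin
  eval (reverse (c ∷ cs)) z                        ≡⟨ cong (λ l → eval l z) (unfold-reverse c cs) ⟩
  eval (reverse cs ++ [ c ]) z                     ≡⟨ eval-++ z (reverse cs) [ c ] ⟩
  eval (reverse cs) z + z ^ length (reverse cs) * (c + z * 0)
    ≡⟨ cong₂ (λ r n → r + z ^ n * (c + z * 0)) (eval-reverse z cs) (length-reverse cs) ⟩
  evalRec z cs + z ^ length cs * (c + z * 0)       ≡⟨ swap (evalRec z cs) (z ^ length cs) c z ⟩
  c * z ^ length cs + evalRec z cs                 ∎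
  where
  swap : ∀ r p c z → r + p * (c + z * 0) ≡ c * p + r
  swap = solve-∀

rev-evalRec : ∀ A → rev A ≡ evalRec 10 (digits A)
rev-evalRec A = eval-reverse 10 (digits A)

length-polyAdd : ∀ p q k → length p + k ≡ length q → length (polyAdd p q) ≡ length q
length-polyAdd []      q       k eq = refl
length-polyAdd (a ∷ p) []      k ()
length-polyAdd (a ∷ p) (b ∷ q) k eq = cong suc (length-polyAdd p q k (suc-injective eq))

-- If p is k entries shorter than q, its reciprocal value is weighted by z^k
-- (p is aligned with the low-order end of q).
evalRec-polyAdd : ∀ z p q k → length p + k ≡ length q →
  evalRec z (polyAdd p q) ≡ z ^ k * evalRec z p + evalRec z q
evalRec-polyAdd z []      q       k eq = sym (cong (_+ evalRec z q) (*-zeroʳ (z ^ k)))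
evalRec-polyAdd z (a ∷ p) []      k ()
evalRec-polyAdd z (a ∷ p) (b ∷ q) k eq = begin
  (a + b) * z ^ length (polyAdd p q) + evalRec z (polyAdd p q)
    ≡⟨ cong₂ (λ n r → (a + b) * z ^ n + r) (length-polyAdd p q k eq′) (evalRec-polyAdd z p q k eq′) ⟩
  (a + b) * z ^ length q + (z ^ k * evalRec z p + evalRec z q)
    ≡⟨ cong (λ w → (a + b) * w + (z ^ k * evalRec z p + evalRec z q)) weight ⟩
  (a + b) * (z ^ length p * z ^ k) + (z ^ k * evalRec z p + evalRec z q)
    ≡⟨ regroup a b (z ^ length p) (z ^ k) (evalRec z p) (evalRec z q) ⟩
  z ^ k * (a * z ^ length p + evalRec z p) + (b * (z ^ length p * z ^ k) + evalRec z q)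
    ≡⟨ cong (λ w → z ^ k * (a * z ^ length p + evalRec z p) + (b * w + evalRec z q)) (sym weight) ⟩
  z ^ k * (a * z ^ length p + evalRec z p) + (b * z ^ length q + evalRec z q) ∎
  where
  eq′ : length p + k ≡ length q
  eq′ = suc-injective eq
  weight : z ^ length q ≡ z ^ length p * z ^ k
  weight = trans (cong (z ^_) (sym eq′)) (^-distribˡ-+-* z (length p) k)
  regroup : ∀ a b P K r s → (a + b) * (P * K) + (K * r + s) ≡ K * (a * P + r) + (b * (P * K) + s)
  regroup = solve-∀

evalRec-scale : ∀ z a q → evalRec z (map (a *_) q) ≡ a * evalRec z q
evalRec-scale z a []      = sym (*-zeroʳ a)
evalRec-scale z a (c ∷ q) = begin
  a * c * z ^ length (map (a *_) q) + evalRec z (map (a *_) q)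
    ≡⟨ cong₂ (λ n r → a * c * z ^ n + r) (length-map (a *_) q) (evalRec-scale z a q) ⟩
  a * c * z ^ length q + a * evalRec z q ≡⟨ factor a c (z ^ length q) (evalRec z q) ⟩
  a * (c * z ^ length q + evalRec z q) ∎
  where
  factor : ∀ a c P r → a * c * P + a * r ≡ a * (c * P + r)
  factor = solve-∀

-- In the recursive step of polyMul (a ∷ ps) q, the scaled copy of q is
-- |ps| entries shorter than the shifted product 0 ∷ ps·q, provided ps·q has the
-- expected length |ps| + |q| - 1.
scaled-is-shorter : ∀ (a b : ℕ) (q ps M : List ℕ) → length M ≡ length ps + suc (length q) →
  length (map (a *_) (b ∷ q)) + suc (length ps) ≡ length (0 ∷ M)
scaled-is-shorter a b q ps M eq = begin
  length (map (a *_) (b ∷ q)) + suc (length ps) ≡⟨ cong (_+ suc (length ps)) (length-map (a *_) (b ∷ q)) ⟩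
  suc (length q + suc (length ps))              ≡⟨ cong suc (+-comm (length q) (suc (length ps))) ⟩
  suc (suc (length ps + length q))              ≡⟨ cong suc (sym (+-suc (length ps) (length q))) ⟩
  suc (length ps + suc (length q))              ≡⟨ cong suc (sym eq) ⟩
  length (0 ∷ M)                                ∎

polyAdd-identityʳ : ∀ p → polyAdd p [] ≡ p
polyAdd-identityʳ []      = refl
polyAdd-identityʳ (a ∷ p) = refl

polyMul-constant : ∀ a b q → polyMul [ a ] (b ∷ q) ≡ map (a *_) (b ∷ q)
polyMul-constant a b q = cong₂ _∷_ (+-identityʳ (a * b)) (polyAdd-identityʳ (map (a *_) q))

length-polyMul : ∀ (a : ℕ) ps b q → length (polyMul (a ∷ ps) (b ∷ q)) ≡ length ps + suc (length q)
length-polyMul a []       b q = trans (cong length (polyMul-constant a b q)) (length-map (a *_) (b ∷ q))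
length-polyMul a (c ∷ ps) b q =
  trans (length-polyAdd (map (a *_) (b ∷ q)) (0 ∷ M) (suc (length ps)) (scaled-is-shorter a b q ps M IH))
        (cong suc IH)
  where
  M : List ℕ
  M = polyMul (c ∷ ps) (b ∷ q)
  IH : length M ≡ length ps + suc (length q)
  IH = length-polyMul c ps b q

evalRec-polyMul : ∀ z (a : ℕ) ps b q →
  evalRec z (polyMul (a ∷ ps) (b ∷ q)) ≡ evalRec z (a ∷ ps) * evalRec z (b ∷ q)
evalRec-polyMul z a []       b q = begin
  evalRec z (polyMul [ a ] (b ∷ q))   ≡⟨ cong (evalRec z) (polyMul-constant a b q) ⟩
  evalRec z (map (a *_) (b ∷ q))      ≡⟨ evalRec-scale z a (b ∷ q) ⟩
  a * evalRec z (b ∷ q)               ≡⟨ constant a (evalRec z (b ∷ q)) ⟩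
  (a * 1 + 0) * evalRec z (b ∷ q)     ∎
  where
  constant : ∀ a r → a * r ≡ (a * 1 + 0) * r
  constant = solve-∀
evalRec-polyMul z a (c ∷ ps) b q = begin
  evalRec z (polyAdd (map (a *_) (b ∷ q)) (0 ∷ M))
    ≡⟨ evalRec-polyAdd z (map (a *_) (b ∷ q)) (0 ∷ M) (suc (length ps))
         (scaled-is-shorter a b q ps M (length-polyMul c ps b q)) ⟩
  z ^ suc (length ps) * evalRec z (map (a *_) (b ∷ q)) + (0 * z ^ length M + evalRec z M)
    ≡⟨ cong₂ (λ u v → z ^ suc (length ps) * u + (0 * z ^ length M + v))
         (evalRec-scale z a (b ∷ q)) (evalRec-polyMul z c ps b q) ⟩
  z ^ suc (length ps) * (a * Q) + (0 * z ^ length M + evalRec z (c ∷ ps) * Q)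
    ≡⟨ collect (z ^ suc (length ps)) a Q (z ^ length M) (evalRec z (c ∷ ps)) ⟩
  (a * z ^ suc (length ps) + evalRec z (c ∷ ps)) * Q ∎
  where
  M : List ℕ
  M = polyMul (c ∷ ps) (b ∷ q)
  Q : ℕ
  Q = evalRec z (b ∷ q)
  collect : ∀ P a Q m s → P * (a * Q) + (0 * m + s * Q) ≡ (a * P + s) * Q
  collect = solve-∀

proposition2 : (A B : ℕ) → A > 0 → B > 0 →
    PolynomialPair A B → PalindromicPair A B
proposition2 A@(suc m) B@(suc n) _ _ polyPair = begin
  rev A * rev B                           ≡⟨ cong₂ _*_ (rev-evalRec A) (rev-evalRec B) ⟩
  evalRec 10 (P A) * evalRec 10 (P B)
    ≡⟨ sym (evalRec-polyMul 10 (A % 10) (digitsAux m (A / 10)) (B % 10) (digitsAux n (B / 10))) ⟩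
  evalRec 10 (polyMul (P A) (P B))        ≡⟨ cong (evalRec 10) polyPair ⟩
  evalRec 10 (P (A * B))                  ≡⟨ sym (rev-evalRec (A * B)) ⟩
  rev (A * B)                             ∎
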